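{- Let $\{G_n\}$ be a positive linear recurrence sequence with recurrence $G_{n+1}=c_1G_n+\cdots+c_LG_{n+1-L}$, and suppose $c_1\ge c_2\ge\cdots\ge c_L$. If $\sum_{j=1}^n a_jG_{n+1-j}$ is a legal decomposition, then $\sum_{j=2}^n a_jG_{n+1-j}$ is a legal decomposition.
   Context: A positive linear recurrence sequence (PLRS) is a sequence $\{G_n\}_{n\ge1}$ of positive integers for which there are non-negative integers $L,c_1,\dots,c_L$ with $L,c_1,c_L$ positive such that $G_{n+1}=c_1G_n+\cdots+c_LG_{n+1-L}$ for $n\ge L$, with initial conditions $G_1=1$ and $G_{n+1}=c_1G_n+\cdots+c_nG_1+1$ for $1\le n<L$. A decomposition $N=\sum_{i=1}^{k}a_iG_{k+1-i}$ of a positive integer $N$ (and the sequence $(a_1,\dots,a_k)$) is legal if $a_1>0$, the other $a_i\ge0$, and either (1) $k<L$ and $a_i=c_i$ for $1\le i\le k$; or (2) there exists $s\in\{0,\dots,L\}$ with $a_1=c_1,\dots,a_{s-1}=c_{s-1}$, $a_s<c_s$, $a_{s+1}=\cdots=a_{s+\ell}=0$ for some $\ell\ge0$, and $(a_{s+\ell+1},\dots,a_k)$ is legal (the recursion terminating with the empty sequence). A coefficient sequence with leading zero coefficients is regarded as legal if it is all zeros or becomes legal after deleting its leading zeros. -}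

module Defs where

open import Data.Nat using (ℕ; zero; suc; _<_; _≥_)
open import Data.List using (List; []; _∷_; _++_; _∷ʳ_; replicate)
open import Data.List.Relation.Unary.All using (All)
open import Data.List.Relation.Unary.Linked using (Linked)
open import Data.Product using (Σ; ∃; _×_; _,_)
open import Data.Sum using (_⊎_)
open import Data.Empty using (⊥)
open import Relation.Binary.PropositionalEquality using (_≡_)

-- The recurrence coefficients (c₁, …, c_L) are given as a list of length L.
-- PLRS condition: L ≥ 1, c₁ > 0, c_L > 0 (the c_i are naturals, hence ≥ 0).
-- The sequence {G_n} is determined by c; legality of a decomposition
-- depends only on its coefficient sequence (a₁, …, a_k) and on c.
IsPLRS : List ℕ → Set
IsPLRS c =
  (Σ ℕ λ c₁ → Σ (List ℕ) λ cs → (c ≡ c₁ ∷ cs) × (0 < c₁)) ×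
  (Σ (List ℕ) λ cs → Σ ℕ λ cL → (c ≡ cs ∷ʳ cL) × (0 < cL))

HeadPos : List ℕ → Set
HeadPos []      = ⊥
HeadPos (x ∷ _) = 0 < x

mutual
  data Legal (c : List ℕ) : List ℕ → Set where
    -- case (1): k < L and a_i = c_i for 1 ≤ i ≤ k
    case1 : ∀ {a y r} → HeadPos a → c ≡ a ++ (y ∷ r) → Legal c a
    -- case (2): with p = (a₁,…,a_{s-1}) = (c₁,…,c_{s-1}), a_s = x < y = c_s
    -- (s = length p + 1 ∈ {1,…,L}), then ℓ zeros, then a legal tail
    case2 : ∀ {p x y r ℓ t} → c ≡ p ++ (y ∷ r) → x < y →
            HeadPos (p ++ (x ∷ (replicate ℓ 0 ++ t))) →
            LegalTail c t →
            Legal c (p ++ (x ∷ (replicate ℓ 0 ++ t)))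

  data LegalTail (c : List ℕ) : List ℕ → Set where
    tail-empty : LegalTail c []
    tail-legal : ∀ {t} → Legal c t → LegalTail c t

-- Convention for sequences with leading zeros: legal if all zeros, or legal
-- after deleting its leading zeros.
LegalZ : List ℕ → List ℕ → Set
LegalZ c a =
  All (_≡ 0) a ⊎
  (Σ ℕ λ ℓ → Σ (List ℕ) λ t → (a ≡ replicate ℓ 0 ++ t) × HeadPos t × Legal c t)

NonIncreasing : List ℕ → Set
NonIncreasing = Linked _≥_

module Submission where

-- Legality of s says that s agrees with c on a prefix and then either
-- stops (before c is exhausted) or cuts below c, followed by zeros and a
-- legal tail.  We make this "s fits under the bound d" a relation Fits d s,
-- generated one entry at a time (stop / cut / keep), so that
-- Legal c s ⇔ (s starts positive) × Fits c s.  If a₁ ∷ as is legal then as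
-- fits under the tail of c.  The key lemma (domination) says: whatever fits
-- under a suffix d of c' also fits under c', whenever c' is a suffix of c.
-- Since c is non-increasing, each entry of d is bounded by the head of c';
-- while they agree we descend, and at the first strict drop we cut and
-- restart the comparison against c itself.  Finally a sequence fitting under
-- c is zeros followed by a legal tail, which is the leading-zeros notion of
-- legality.

open import Defs
open import Data.Nat using (ℕ; zero; suc; _<_; _≤_; s≤s; z≤n)
open import Data.Nat.Properties using (≤-refl; ≤-trans; <-≤-trans; m≤n⇒m<n∨m≡n)
open import Data.List using (List; []; _∷_; _++_; replicate; [_])
open import Data.List.Properties using (++-assoc; ++-identityʳ)
open import Data.List.Relation.Unary.All using ([])
open import Data.List.Relation.Unary.All.Properties using (++⁺; replicate⁺)
open import Data.List.Relation.Unary.Linked using ([-]; _∷_)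
import Data.List.Relation.Unary.Linked as Linked
open import Data.Product using (∃₂; _×_; _,_)
open import Data.Sum using (inj₁; inj₂)
open import Relation.Binary.PropositionalEquality using (_≡_; refl; sym; trans; subst)

infix 4 _≼_
data _≼_ {A : Set} : List A → List A → Set where
  ≼-refl : ∀ {xs} → xs ≼ xs
  ≼-drop : ∀ {y xs ys} → xs ≼ ys → xs ≼ y ∷ ys

≼-trans : ∀ {A : Set} {xs ys zs : List A} → xs ≼ ys → ys ≼ zs → xs ≼ zs
≼-trans p ≼-refl     = p
≼-trans p (≼-drop q) = ≼-drop (≼-trans p q)

≼-tail : ∀ {A : Set} {x : A} {xs ys} → x ∷ xs ≼ ys → xs ≼ ys
≼-tail = ≼-trans (≼-drop ≼-refl)

suffix-nonIncreasing : ∀ {xs ys} → xs ≼ ys → NonIncreasing ys → NonIncreasing xs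
suffix-nonIncreasing ≼-refl     desc = desc
suffix-nonIncreasing (≼-drop p) desc = suffix-nonIncreasing p (Linked.tail desc)

suffix-head-≤ : ∀ {x y xs ys} → NonIncreasing (y ∷ ys) → x ∷ xs ≼ y ∷ ys → x ≤ y
suffix-head-≤ _             ≼-refl     = ≤-refl
suffix-head-≤ [-]           (≼-drop ())
suffix-head-≤ (y≥z ∷ desc) (≼-drop p) = ≤-trans (suffix-head-≤ desc p) y≥z

legal⇒headPos : ∀ {c s} → Legal c s → HeadPos s
legal⇒headPos (case1 hp _)     = hp
legal⇒headPos (case2 _ _ hp _) = hp

module Domination (c : List ℕ) where

  ZerosThenTail : List ℕ → Set
  ZerosThenTail s = ∃₂ λ ℓ t → s ≡ replicate ℓ 0 ++ t × LegalTail c t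

  zerosThenTail⇒LegalZ : ∀ {s} → ZerosThenTail s → LegalZ c s
  zerosThenTail⇒LegalZ (ℓ , [] , refl , tail-empty) = inj₁ (++⁺ (replicate⁺ ℓ refl) [])
  zerosThenTail⇒LegalZ (ℓ , t  , refl , tail-legal leg) =
    inj₂ (ℓ , t , refl , legal⇒headPos leg , leg)

  data Fits : List ℕ → List ℕ → Set where
    stop : ∀ {y r} → Fits (y ∷ r) []
    cut  : ∀ {x y r s} → x < y → ZerosThenTail s → Fits (y ∷ r) (x ∷ s)
    keep : ∀ {y d s} → Fits d s → Fits (y ∷ d) (y ∷ s)

  keeps : ∀ p {d s} → Fits d s → Fits (p ++ d) (p ++ s)
  keeps []      f = f
  keeps (y ∷ p) f = keep (keeps p f)

  prefix-fits : ∀ p {y r} → Fits (p ++ y ∷ r) p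
  prefix-fits []      = stop
  prefix-fits (y ∷ p) = keep (prefix-fits p)

  legal⇒fits : ∀ {s} → Legal c s → Fits c s
  legal⇒fits (case1 {a} _ eq) = subst (λ d → Fits d a) (sym eq) (prefix-fits a)
  legal⇒fits (case2 {p} {ℓ = ℓ} {t} eq lt _ tl) =
    subst (λ d → Fits d (p ++ _)) (sym eq) (keeps p (cut lt (ℓ , t , refl , tl)))

  fits⇒legal : ∀ q {d s} → c ≡ q ++ d → Fits d s → HeadPos (q ++ s) → Legal c (q ++ s)
  fits⇒legal q eq stop hp =
    subst (Legal c) (sym (++-identityʳ q)) (case1 (subst HeadPos (++-identityʳ q) hp) eq)
  fits⇒legal q eq (cut lt (ℓ , t , refl , tl)) hp = case2 eq lt hp tl
  fits⇒legal q eq (keep {y} {d} {s} f) hp =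
    subst (Legal c) (++-assoc q [ y ] s)
      (fits⇒legal (q ++ [ y ]) (trans eq (sym (++-assoc q [ y ] d))) f
        (subst HeadPos (sym (++-assoc q [ y ] s)) hp))

  module _ (c-head : HeadPos c) (c-desc : NonIncreasing c) where

    -- Fitting under c itself means zeros followed by a legal tail: a kept
    -- first entry equals c₁ > 0, and a positive cut entry starts a legal run.
    fits⇒zerosThenTail : ∀ {s} → Fits c s → ZerosThenTail s
    fits⇒zerosThenTail stop = 0 , [] , refl , tail-empty
    fits⇒zerosThenTail (cut {zero} _ (ℓ , t , refl , tl)) = suc ℓ , t , refl , tl
    fits⇒zerosThenTail f@(cut {suc _} _ _) =
      0 , _ , refl , tail-legal (fits⇒legal [] refl f (s≤s z≤n))
    fits⇒zerosThenTail f@(keep _) =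
      0 , _ , refl , tail-legal (fits⇒legal [] refl f c-head)

    head-bound : ∀ {x xs y c''} → y ∷ c'' ≼ c → x ∷ xs ≼ c'' → x ≤ y
    head-bound c'≼c p = suffix-head-≤ (suffix-nonIncreasing c'≼c c-desc) (≼-drop p)

    -- Entries of d are bounded by the head of c'; on equality we descend, on a
    -- strict drop we cut and restart the comparison against c.
    dominate : ∀ {c' d s} → c' ≼ c → d ≼ c' → Fits d s → Fits c' s
    dominate _    ≼-refl         f    = f
    dominate _    (≼-drop _)     stop = stop
    dominate c'≼c (≼-drop d≼c'') (cut lt zt) =
      cut (<-≤-trans lt (head-bound c'≼c d≼c'')) zt
    dominate c'≼c (≼-drop d≼c'') (keep f) with m≤n⇒m<n∨m≡n (head-bound c'≼c d≼c'')
    ... | inj₂ refl = keep (dominate (≼-tail c'≼c) (≼-tail d≼c'') f)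
    ... | inj₁ lt   =
      cut lt (fits⇒zerosThenTail (dominate ≼-refl (≼-trans (≼-tail d≼c'') (≼-tail c'≼c)) f))

    legal-dropHead : ∀ {a s} → Legal c (a ∷ s) → ZerosThenTail s
    legal-dropHead leg = fits-dropHead (legal⇒fits leg)
      where
        fits-dropHead : ∀ {a s} → Fits c (a ∷ s) → ZerosThenTail s
        fits-dropHead (cut _ zt) = zt
        fits-dropHead (keep f)   = fits⇒zerosThenTail (dominate ≼-refl (≼-drop ≼-refl) f)

plrs⇒headPos : ∀ {c} → IsPLRS c → HeadPos c
plrs⇒headPos ((_ , _ , refl , c₁>0) , _) = c₁>0

mainTheorem3 : (c : List ℕ) → IsPLRS c → NonIncreasing c →
    (a₁ : ℕ) (as : List ℕ) → Legal c (a₁ ∷ as) → LegalZ c as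
mainTheorem3 c plrs desc a₁ as leg =
  zerosThenTail⇒LegalZ (legal-dropHead (plrs⇒headPos plrs) desc leg)
  where open Domination c
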